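{- Let $\mathsf{P}\in\mathbb{P}_{\mathrm{lay}}$ and let $F\subseteq\omega$ be finite. (1) If $F\in\mathcal{C}(\mathcal{A}_\mathsf{P})$, then the set $\{p\in P\mid l_p(p)\subseteq F\}$ has an upper bound in $P$, and hence a unique supremum $s_F\in P$. (2) If $F\in\mathcal{C}(\mathcal{A}_\mathsf{P})$, then $F\in\mathcal{A}_\mathsf{P}$ if and only if $\mathrm{col}_p(s_F)=1$ and $l_p(s_F)=F$.
   Context: A 2-colored poset is $\mathsf{P}=(P,\leq_p,\mathrm{col}_p)$ with $\leq_p$ a partial order and $\mathrm{col}_p:P\to\{0,1\}$. An injective homomorphism $\varphi$ between 2-colored posets (order- and color-preserving) which maps immediate predecessors to immediate predecessors is written $\cdot\rightarrowtail_c\cdot$. Shrubs: a countable poset $(P,\leq_p)$ is a shrub if (1) there is no injective order-preserving map from $(\omega,\leq)$ into $P$; (2) every $p\in P$ has finitely many elements $\leq_p p$; (3) there is a $\leq_p$-minimal element, denoted $\bot$; (4) $P$ is bounded complete: every subset having an upper bound has a least upper bound. $\mathbb{P}_{\mathrm{lay}}$ is the class of countable 2-colored posets $\mathsf{P}$ whose underlying poset is a shrub and such that: (a) $\mathrm{col}_p(\bot)=0$; (b) every $\leq_p$-maximal element has color $1$; (c) none of the following satisfies $\cdot\rightarrowtail_c\mathsf{P}$: $\vee^0_1$ ($a<b$, $a<c$, $b\perp c$, $\mathrm{col}(a)=1$, $\mathrm{col}(b)=\mathrm{col}(c)=0$), $\wedge^1_0$ ($a<c$, $b<c$, $a\perp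 b$, $\mathrm{col}(c)=1$, $\mathrm{col}(a)=\mathrm{col}(b)=0$), $\mid^1_1$ ($a<b$, both of color $1$). Identify the underlying set of $\mathsf{P}$ with some $\alpha\in\omega\cup\{\omega\}$. The labeling $l_p:P\to\mathcal{P}_{<\omega}(\omega)$ is $l_p(\bot)=\emptyset$ and $l_p(n)=\{k\in P\mid k\leq_p n\}$ for $n\neq\bot$. $\mathcal{A}_\mathsf{P}=\{l_p(p)\mid p\in P,\ \mathrm{col}_p(p)=1\}$ and $\mathcal{C}(\mathcal{A}_\mathsf{P})=\{F\subseteq\omega\mid \exists p\in P\ F\subseteq l_p(p)\}$. -}

module Defs where

open import Data.Nat using (ℕ; zero; suc) renaming (_≤_ to _≤ℕ_; _<_ to _<ℕ_)
open import Data.Fin using (Fin; zero; suc)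
open import Data.Bool using (Bool; true; false)
open import Data.Maybe using (Maybe; just; nothing)
open import Data.Unit using (⊤)
open import Data.Empty using (⊥)
open import Data.Product using (Σ; ∃; _×_; _,_)
open import Data.Sum using (_⊎_)
open import Data.List using (List)
open import Data.List.Membership.Propositional using (_∈_)
open import Relation.Nullary using (¬_)
open import Relation.Binary.PropositionalEquality using (_≡_; _≢_; refl; isEquivalence)
open import Relation.Binary.Structures using (IsPartialOrder; IsPreorder)
open import Function.Definitions using (Injective)

-- Colours: false = 0, true = 1.

record ColPosetOn (A : Set) : Set₁ where
  field
    _≤_ : A → A → Set
    col : A → Bool
    isPartialOrder : IsPartialOrder _≡_ _≤_

module _ {A : Set} (P : ColPosetOn A) where
  open ColPosetOn P
  ImmPred : A → A → Set
  ImmPred a b = (a ≤ b) × (a ≢ b) × (∀ c → a ≤ c → c ≤ b → (c ≡ a) ⊎ (c ≡ b))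

record _↣c_ {A B : Set} (Q : ColPosetOn A) (P : ColPosetOn B) : Set where
  module Q = ColPosetOn Q
  module P = ColPosetOn P
  field
    φ : A → B
    injective : Injective _≡_ _≡_ φ
    monotone : ∀ {x y} → x Q.≤ y → φ x P.≤ φ y
    colour : ∀ x → P.col (φ x) ≡ Q.col x
    immPred : ∀ {x y} → ImmPred Q x y → ImmPred P (φ x) (φ y)

data ≤∨ : Fin 3 → Fin 3 → Set where
  rfl : ∀ {x} → ≤∨ x x
  ab : ≤∨ zero (suc zero)
  ac : ≤∨ zero (suc (suc zero))

∨-po : IsPartialOrder _≡_ ≤∨
∨-po = record
  { isPreorder = record
    { isEquivalence = isEquivalence
    ; reflexive = λ { refl → rfl }
    ; trans = tr }
  ; antisym = as }
  where
  tr : ∀ {i j k} → ≤∨ i j → ≤∨ j k → ≤∨ i k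
  tr rfl q = q
  tr ab rfl = ab
  tr ac rfl = ac
  as : ∀ {i j} → ≤∨ i j → ≤∨ j i → i ≡ j
  as rfl _ = refl
  as ab ()
  as ac ()

col∨ : Fin 3 → Bool
col∨ zero = true
col∨ (suc _) = false

Pat∨⁰₁ : ColPosetOn (Fin 3)
Pat∨⁰₁ = record { _≤_ = ≤∨ ; col = col∨ ; isPartialOrder = ∨-po }

data ≤∧ : Fin 3 → Fin 3 → Set where
  rfl : ∀ {x} → ≤∧ x x
  ac : ≤∧ zero (suc (suc zero))
  bc : ≤∧ (suc zero) (suc (suc zero))

∧-po : IsPartialOrder _≡_ ≤∧
∧-po = record
  { isPreorder = record
    { isEquivalence = isEquivalence
    ; reflexive = λ { refl → rfl }
    ; trans = tr }
  ; antisym = as }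
  where
  tr : ∀ {i j k} → ≤∧ i j → ≤∧ j k → ≤∧ i k
  tr rfl q = q
  tr ac rfl = ac
  tr bc rfl = bc
  as : ∀ {i j} → ≤∧ i j → ≤∧ j i → i ≡ j
  as rfl _ = refl
  as ac ()
  as bc ()

col∧ : Fin 3 → Bool
col∧ (suc (suc zero)) = true
col∧ _ = false

Pat∧¹₀ : ColPosetOn (Fin 3)
Pat∧¹₀ = record { _≤_ = ≤∧ ; col = col∧ ; isPartialOrder = ∧-po }

data ≤∣ : Fin 2 → Fin 2 → Set where
  rfl : ∀ {x} → ≤∣ x x
  ab : ≤∣ zero (suc zero)

∣-po : IsPartialOrder _≡_ ≤∣
∣-po = record
  { isPreorder = record
    { isEquivalence = isEquivalence
    ; reflexive = λ { refl → rfl }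
    ; trans = tr }
  ; antisym = as }
  where
  tr : ∀ {i j k} → ≤∣ i j → ≤∣ j k → ≤∣ i k
  tr rfl q = q
  tr ab rfl = ab
  as : ∀ {i j} → ≤∣ i j → ≤∣ j i → i ≡ j
  as rfl _ = refl
  as ab ()

Pat∣¹₁ : ColPosetOn (Fin 2)
Pat∣¹₁ = record { _≤_ = ≤∣ ; col = λ _ → true ; isPartialOrder = ∣-po }

-- Underlying set identified with α ∈ ω ∪ {ω}:
-- nothing = ω, just a = a = {0,…,a-1}.

InDom : Maybe ℕ → ℕ → Set
InDom (just a) n = n <ℕ a
InDom nothing n = ⊤

Dom : Maybe ℕ → Set
Dom α = Σ ℕ (InDom α)

module _ {A : Set} (_≤_ : A → A → Set) where
  UpperBound : (A → Set) → A → Set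
  UpperBound S u = ∀ p → S p → p ≤ u

  IsLUB : (A → Set) → A → Set
  IsLUB S s = UpperBound S s × (∀ u → UpperBound S u → s ≤ u)

record IsShrub {A : Set} (P : ColPosetOn A) : Set₁ where
  open ColPosetOn P
  field
    noωChain : ¬ (Σ (ℕ → A) λ f → Injective _≡_ _≡_ f × (∀ {m n} → m ≤ℕ n → f m ≤ f n))
    finiteDown : ∀ p → Σ (List A) λ L → ∀ q → q ≤ p → q ∈ L
    bot : A
    bot-minimal : ∀ q → q ≤ bot → q ≡ bot
    boundedComplete : ∀ (S : A → Set) → (Σ A (UpperBound _≤_ S)) → Σ A (IsLUB _≤_ S)

record IsLay {α : Maybe ℕ} (P : ColPosetOn (Dom α)) : Set₁ where
  open ColPosetOn P
  field
    shrub : IsShrub P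
  open IsShrub shrub public
  field
    col-bot : col bot ≡ false
    maximal-col : ∀ p → (∀ q → p ≤ q → q ≡ p) → col p ≡ true
    no∨⁰₁ : ¬ (Pat∨⁰₁ ↣c P)
    no∧¹₀ : ¬ (Pat∧¹₀ ↣c P)
    no∣¹₁ : ¬ (Pat∣¹₁ ↣c P)

-- Labelling, 𝒜_P and 𝒞(𝒜_P).  Finite subsets of ω are lists
-- (read as the set of their members); l_p(p) is a predicate on ℕ.

module Lay {α : Maybe ℕ} (P : ColPosetOn (Dom α)) (L : IsLay P) where
  open ColPosetOn P
  open IsLay L

  lab : Dom α → ℕ → Set
  lab p k = (p ≢ bot) × Σ (InDom α k) λ h → (k , h) ≤ p

  _⊆l_ : List ℕ → Dom α → Set
  F ⊆l p = ∀ k → k ∈ F → lab p k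

  _l⊆_ : Dom α → List ℕ → Set
  p l⊆ F = ∀ k → lab p k → k ∈ F

  _l≐_ : Dom α → List ℕ → Set
  p l≐ F = (p l⊆ F) × (F ⊆l p)

  In𝒜 : List ℕ → Set
  In𝒜 F = Σ (Dom α) λ p → (col p ≡ true) × (p l≐ F)

  In𝒞 : List ℕ → Set
  In𝒞 F = Σ (Dom α) λ p → F ⊆l p

  Below : List ℕ → Dom α → Set
  Below F p = p l⊆ F

module Submission where

open import Defs
open import Data.Nat using (ℕ)
open import Data.Bool using (true)
open import Data.Maybe using (Maybe; just; nothing)
open import Data.List using (List)
open import Data.Product using (Σ; _×_; _,_; proj₁; proj₂)
open import Data.Product.Properties using (≡-dec)
open import Data.Empty using (⊥)
open import Data.Unit using (tt)
import Data.Nat.Properties as ℕ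
open import Function.Bundles using (_⇔_; mk⇔)
open import Relation.Binary.Definitions using (DecidableEquality)
open import Relation.Binary.PropositionalEquality using (_≡_; refl; subst)
open import Relation.Binary.Structures using (IsPartialOrder)
open import Relation.Nullary using (yes; no)

-- If F ⊆ l(p), every q with l(q) ⊆ F lies below p: q ∈ l(q) ⊆ F ⊆ l(p)
-- unless q = ⊥, and ⊥ is least, being the supremum of ∅ in a bounded
-- complete poset.  Bounded completeness then yields s_F, unique by
-- antisymmetry.  If moreover l(p) = F, then p is the greatest element of
-- {q | l(q) ⊆ F}, so p = s_F.

module _ {A : Set} {_≤_ : A → A → Set} (po : IsPartialOrder _≡_ _≤_) where
  open IsPartialOrder po using (antisym)

  IsLUB-unique : ∀ {S s s′} → IsLUB _≤_ S s → IsLUB _≤_ S s′ → s′ ≡ s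
  IsLUB-unique (ub , least) (ub′ , least′) = antisym (least′ _ ub) (least _ ub′)

  greatest⇒IsLUB : ∀ {S p} → S p → UpperBound _≤_ S p → IsLUB _≤_ S p
  greatest⇒IsLUB Sp ub = ub , λ _ ub′ → ub′ _ Sp

module _ {A : Set} {P : ColPosetOn A} (shrub : IsShrub P) where
  open ColPosetOn P
  open IsShrub shrub

  bot-least : ∀ p → bot ≤ p
  bot-least p with boundedComplete (λ _ → ⊥) (p , λ _ ())
  ... | s , _ , least with bot-minimal s (least bot λ _ ())
  ... | refl = least p λ _ ()

InDom-irrelevant : ∀ α {n} (h h′ : InDom α n) → h ≡ h′
InDom-irrelevant (just a) h h′ = ℕ.<-irrelevant h h′
InDom-irrelevant nothing tt tt = refl

Dom-≟ : ∀ α → DecidableEquality (Dom α)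
Dom-≟ α = ≡-dec ℕ._≟_ λ h h′ → yes (InDom-irrelevant α h h′)

module _ {α : Maybe ℕ} (P : ColPosetOn (Dom α)) (L : IsLay P) where
  open ColPosetOn P
  open IsLay L
  open Lay P L
  open IsPartialOrder isPartialOrder using () renaming (refl to ≤-refl)

  ⊆l⇒UpperBound : ∀ {F p} → F ⊆l p → UpperBound _≤_ (Below F) p
  ⊆l⇒UpperBound {F} {p} F⊆p q q⊆F with Dom-≟ α q bot
  ... | yes refl = bot-least shrub p
  ... | no q≢bot with F⊆p _ (q⊆F _ (q≢bot , _ , ≤-refl))
  ...   | _ , h , n≤p = subst (λ h → (_ , h) ≤ p) (InDom-irrelevant α h _) n≤p

  l≐⇒IsLUB : ∀ {F p} → p l≐ F → IsLUB _≤_ (Below F) p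
  l≐⇒IsLUB (p⊆F , F⊆p) = greatest⇒IsLUB isPartialOrder p⊆F (⊆l⇒UpperBound F⊆p)

  In𝒜⇔ : ∀ F {s} → IsLUB _≤_ (Below F) s → In𝒜 F ⇔ ((col s ≡ true) × (s l≐ F))
  In𝒜⇔ F {s} lub = mk⇔ to (λ c,s≐F → _ , c,s≐F)
    where
    to : In𝒜 F → (col s ≡ true) × (s l≐ F)
    to (p , c , p≐F) with IsLUB-unique isPartialOrder (l≐⇒IsLUB p≐F) lub
    ... | refl = c , p≐F

lemma20 : (α : Maybe ℕ) (P : ColPosetOn (Dom α)) (L : IsLay P) (F : List ℕ) →
    let open ColPosetOn P in
    let open Lay P L in
    In𝒞 F →
      Σ (Dom α) (UpperBound _≤_ (Below F))
      × Σ (Dom α) (λ s → IsLUB _≤_ (Below F) s × (∀ s′ → IsLUB _≤_ (Below F) s′ → s′ ≡ s))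
      × (∀ s → IsLUB _≤_ (Below F) s → (In𝒜 F ⇔ ((col s ≡ true) × (s l≐ F))))
lemma20 α P L F (p , F⊆p) =
  bound , (s , lub , λ _ → IsLUB-unique isPartialOrder lub) , λ _ → In𝒜⇔ P L F
  where
  open ColPosetOn P
  open IsLay L
  bound : Σ (Dom α) (UpperBound _≤_ (Lay.Below P L F))
  bound = p , ⊆l⇒UpperBound P L F⊆p
  s : Dom α
  s = proj₁ (boundedComplete _ bound)
  lub : IsLUB _≤_ (Lay.Below P L F) s
  lub = proj₂ (boundedComplete _ bound)
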